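{- In the folding setting described in the context: (1) For all $\alpha^\vee\in Q^\vee_A$ and $\lambda\in P'_A$, $\langle\varphi(\alpha^\vee),\psi(\lambda)\rangle=\kappa\,\langle\alpha^\vee,\lambda\rangle$. (2) For all $\Lambda\in P'_A$ and $w\in W_A$, $\psi(w\Lambda)=f(w)\psi(\Lambda)$. (3) For all $w\in W_A$, $\Lambda\in P'_A$ and $\alpha^\vee\in Q_A^\vee$, $\langle\varphi(\alpha^\vee),f(w)\psi(\Lambda)\rangle=\kappa\langle\alpha^\vee,w\Lambda\rangle$; in particular, for $i\in I$, $\langle\tilde\beta_i^\vee,f(w)\psi(\Lambda)\rangle=\kappa\langle\alpha_i^\vee,w\Lambda\rangle$, where $\tilde\beta_i^\vee=\sum_{j\in O_i}\beta_j^\vee$. (4) The map $\varphi$ sends $Q^\vee_A\cap Z(\mathfrak{g}(A))$ into $Z(\mathfrak{g}(B))$.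
   Context: Let $B=(b_{jk})_{j,k\in J}$ be a generalized Cartan matrix (GCM) and $\pi$ a permutation of $J$ with $b_{\pi(j)\pi(k)}=b_{jk}$ for all $j,k$, which is admissible: $b_{jk}=0$ whenever $j,k$ lie in the same $\pi$-orbit. Let $I$ index the $\pi$-orbits, $O_i\subset J$ the orbit indexed by $i$, $o_i=|O_i|$, and let $A=(a_{i'i})_{i',i\in I}$ be the GCM given by $a_{i'i}=\frac{o_{i'}}{o_i}\sum_{j\in O_i}b_{j'j}$ for any $j'\in O_{i'}$. For $\mathfrak{g}(A)$ let $\alpha_i,\alpha_i^\vee,\Lambda_i$ be the simple roots, simple coroots, fundamental weights and $W_A$ the Weyl group with generators $s_i^A$; for $\mathfrak{g}(B)$ let $\beta_j,\beta_j^\vee,\omega_j$ and $W_B$ with generators $s_j^B$ be the analogous data. $Q^\vee_A,Q^\vee_B$ are the coroot lattices. $P'_A$ is the weight lattice of $\mathfrak{g}(A)$ modulo the annihilator of all the $\alpha_i^\vee$ (so the pairing with coroots and the $W_A$-action descend to it), similarly $P'_B$; $\alpha_i,\Lambda_i$ etc. also denote their images. Let $\kappa=\mathrm{lcm}_{i\in I}(o_i)$. Define $\psi:P'_A\to P'_B$ linearly by $\psi(\Lambda_i)=\frac{\kappa}{o_i}\sum_{j\in O_i}\omega_j$ and $\varphi:Q^\vee_A\to Q^\vee_B$ by $\varphi(\alpha_i^\vee)=\sum_{j\in O_i}\beta_j^\vee$. Let $f:W_A\to W_B$ be the group homomorphism with $f(s_i^A)=\prod_{j\in O_i}s_j^B$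 (the factors commute by admissibility; $f$ is a well-defined injective homomorphism). $Z(\mathfrak{g})$ denotes the center. -}

module Defs where

open import Data.Nat as ℕ using (ℕ; zero; suc)
open import Data.Nat.DivMod using (_/_)
open import Data.Nat.LCM using (lcm)
open import Data.Integer as ℤ using (ℤ; +_; _*_; _-_; _≤_)
open import Data.Fin using (Fin; zero; suc; _≟_)
open import Data.Fin.Permutation using (Permutation′; _⟨$⟩ʳ_)
open import Data.List using (List; []; _∷_; filter; length; allFin; concatMap; foldr; map)
open import Data.Product using (Σ; ∃; _×_; _,_)
open import Relation.Nullary using (¬_; yes; no)
open import Relation.Binary.PropositionalEquality using (_≡_; _≢_)

∑ : {m : ℕ} → (Fin m → ℤ) → ℤ
∑ {zero}  f = + 0
∑ {suc m} f = f zero ℤ.+ ∑ (λ i → f (suc i))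

-- natural-number division, total (only used with a nonzero divisor)
_div_ : ℕ → ℕ → ℕ
a div zero    = 0
a div (suc k) = a / suc k

Matrix : ℕ → Set
Matrix n = Fin n → Fin n → ℤ

record IsGCM {n : ℕ} (C : Matrix n) : Set where
  field
    diag   : ∀ j → C j j ≡ + 2
    offneg : ∀ j k → j ≢ k → C j k ≤ + 0
    zerosym : ∀ j k → C j k ≡ + 0 → C k j ≡ + 0

iter : {n : ℕ} → Permutation′ n → ℕ → Fin n → Fin n
iter π zero    j = j
iter π (suc t) j = π ⟨$⟩ʳ (iter π t j)

SameOrbit : {n : ℕ} → Permutation′ n → Fin n → Fin n → Set
SameOrbit π j k = ∃ λ (t : ℕ) → iter π t j ≡ k

-- Folding data: B on J = Fin n, π, and an indexing orb : J → I = Fin m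
-- of the π-orbits (orb j ≡ orb k iff j, k lie in the same orbit; every
-- i ∈ I indexes some orbit), and the GCM A on I = Fin m determined by
-- o_i a_{i'i} = o_{i'} ∑_{j ∈ O_i} b_{j'j}  (j' ∈ O_{i'}).

orbitList : {n m : ℕ} → (Fin n → Fin m) → Fin m → List (Fin n)
orbitList orb i = filter (λ j → orb j ≟ i) (allFin _)

osize : {n m : ℕ} → (Fin n → Fin m) → Fin m → ℕ
osize orb i = length (orbitList orb i)

∑orb : {n m : ℕ} → (Fin n → Fin m) → Fin m → (Fin n → ℤ) → ℤ
∑orb orb i g = ∑ (λ j → case-orb (orb j ≟ i) (g j))
  where
  case-orb : {P : Set} → Relation.Nullary.Dec P → ℤ → ℤ
  case-orb (yes _) z = z
  case-orb (no _)  z = + 0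

record Folding (n m : ℕ) : Set where
  field
    B      : Matrix n
    B-gcm  : IsGCM B
    π      : Permutation′ n
    B-inv  : ∀ j k → B (π ⟨$⟩ʳ j) (π ⟨$⟩ʳ k) ≡ B j k
    admissible : ∀ j k → j ≢ k → SameOrbit π j k → B j k ≡ + 0
    orb    : Fin n → Fin m
    orb-surj : ∀ i → ∃ λ j → orb j ≡ i
    orb-sound : ∀ j k → orb j ≡ orb k → SameOrbit π j k
    orb-complete : ∀ j k → SameOrbit π j k → orb j ≡ orb k
    A      : Matrix m
    A-def  : ∀ i' i j' → orb j' ≡ i' →
             + (osize orb i) * A i' i ≡ + (osize orb i') * ∑orb orb i (λ j → B j' j)

-- P' of a GCM C on Fin k is modelled as ℤ^k via λ ↦ (⟨α_i^∨, λ⟩)_i,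
-- i.e. coordinates in the fundamental weights; the simple root α_i has
-- coordinates k ↦ C k i.  The coroot lattice Q^∨ is ℤ^k (coefficients
-- w.r.t. the simple coroots).

Wt : ℕ → Set
Wt k = Fin k → ℤ

CoRt : ℕ → Set
CoRt k = Fin k → ℤ

⟪_,_⟫ : {k : ℕ} → CoRt k → Wt k → ℤ
⟪ c , λw ⟫ = ∑ (λ i → c i * λw i)

-- simple reflection s_i λ = λ - ⟨α_i^∨,λ⟩ α_i
refl-s : {k : ℕ} → Matrix k → Fin k → Wt k → Wt k
refl-s C i λw = λ l → λw l - λw i * C l i

-- Weyl group elements as words in the simple reflections;
-- (i₁ ∷ … ∷ iₖ) stands for s_{i₁} ⋯ s_{iₖ}
Word : ℕ → Set
Word k = List (Fin k)

act : {k : ℕ} → Matrix k → Word k → Wt k → Wt k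
act C []      λw = λw
act C (i ∷ w) λw = refl-s C i (act C w λw)

-- ℤ-linear map ψ : P'_A → P'_B, ψ(Λ_i) = (κ/o_i) ∑_{j∈O_i} ω_j
module _ {n m : ℕ} (F : Folding n m) where
  open Folding F

  o : Fin m → ℕ
  o = osize orb

  κ : ℕ
  κ = foldr lcm 1 (map o (allFin m))

  ψ : Wt m → Wt n
  ψ λw j = + (κ div o (orb j)) * λw (orb j)

  -- φ : Q^∨_A → Q^∨_B, φ(α_i^∨) = ∑_{j∈O_i} β_j^∨
  φ : CoRt m → CoRt n
  φ c j = c (orb j)

  f : Word m → Word n
  f = concatMap (orbitList orb)

  β̃ : Fin m → CoRt n
  β̃ i j = case (orb j ≟ i)
    where
    case : {P : Set} → Relation.Nullary.Dec P → ℤ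
    case (yes _) = + 1
    case (no _)  = + 0

  αᵛ : Fin m → CoRt m
  αᵛ i l = case (l ≟ i)
    where
    case : {P : Set} → Relation.Nullary.Dec P → ℤ
    case (yes _) = + 1
    case (no _)  = + 0

-- membership of a coroot-lattice element h in the centre of g(C):
-- α_i(h) = 0 for all simple roots α_i, i.e. ∑_l h_l C_{l i} = 0.
InCentre : {k : ℕ} → Matrix k → CoRt k → Set
InCentre C h = ∀ i → ∑ (λ l → h l * C l i) ≡ + 0

{-# OPTIONS --safe #-}
module Submission where

-- ψ sends Λ_i to (κ/o_i) ∑_{j∈O_i} ω_j and φ spreads α_i^∨ over O_i, so ⟨φ c, ψ λ⟩ counts the
-- i-th term o_i times, with weight κ/o_i: this gives κ⟨c,λ⟩.  By admissibility the reflections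
-- s_j (j ∈ O_i) are mutually orthogonal, so f(s_i) subtracts ∑_{j∈O_i} ⟨β_j^∨,·⟩ β_j; on ψ(μ)
-- this is ψ(s_i μ), because the relation o_i a_{yi} = o_y ∑_{j∈O_i} b_{j'j} (j' ∈ O_y) rescales to
-- (κ/o_y) a_{yi} = (κ/o_i) ∑_{j∈O_i} b_{j'j}.  For the centre,
-- π-invariance of B makes the column sums ∑_{l∈O_x} b_{lk} constant on orbits, and double counting
-- over the block O_x × O_{orb k} identifies them with a_{x,orb k}; hence
-- ∑_l c_{orb l} b_{lk} = ∑_x c_x a_{x,orb k} = 0.

open import Defs
open import Data.Nat using (ℕ)
open import Data.Integer using (ℤ; +_; _*_)
open import Data.Fin using (Fin)
open import Data.Product using (_×_)
open import Relation.Binary.PropositionalEquality using (_≡_)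

import Data.Integer.Properties as ℤ
open import Algebra.Properties.CommutativeSemigroup ℤ.*-commutativeSemigroup using (x∙yz≈y∙xz)
import Algebra.Properties.Semiring.Sum as SemiringSum
open import Data.Bool.Base using (if_then_else_)
open import Data.Nat as ℕ using (zero; suc; NonZero)
open import Data.Nat.DivMod using (m/n*n≡m)
open import Data.Nat.Divisibility using (_∣_; ∣-trans)
open import Data.Nat.LCM using (lcm; m∣lcm[m,n]; n∣lcm[m,n])
open import Data.Integer using (_+_; _-_)
open import Data.Integer.Tactic.RingSolver using (solve-∀)
open import Data.Fin using (zero; suc; _≟_)
open import Data.Fin.Permutation using (Permutation′; _⟨$⟩ʳ_)
open import Data.List using (List; []; _∷_; _++_; map; foldr; filter; tabulate; allFin; length)
open import Data.List.Membership.Propositional using (_∈_)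
open import Data.List.Membership.Propositional.Properties using (∈-filter⁺; ∈-allFin; ∈-map⁺)
open import Data.List.Relation.Unary.All as All using (All; []; _∷_)
open import Data.List.Relation.Unary.All.Properties using (all-filter)
open import Data.List.Relation.Unary.AllPairs using (AllPairs; []; _∷_)
import Data.List.Relation.Unary.AllPairs.Properties as AllPairs
open import Data.List.Relation.Unary.Any using (here; there)
open import Data.List.Relation.Unary.Unique.Propositional.Properties using (allFin⁺)
open import Data.Product using (_,_)
open import Function using (_∘_)
open import Relation.Nullary using (Dec; does; yes; no)
open import Relation.Unary using (Decidable)
open import Relation.Binary.PropositionalEquality
  using (_≢_; _≗_; refl; sym; trans; cong; cong₂; module ≡-Reasoning)

open ≡-Reasoning

private
  module Sum = SemiringSum ℤ.+-*-semiring

  variable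
    k n m m′ : ℕ

∑≡sum : (h : Fin n → ℤ) → ∑ h ≡ Sum.sum h
∑≡sum {zero}  h = refl
∑≡sum {suc n} h = cong (_+_ (h zero)) (∑≡sum (h ∘ suc))

∑-cong : {g h : Fin n → ℤ} → g ≗ h → ∑ g ≡ ∑ h
∑-cong {zero}  g≗h = refl
∑-cong {suc n} g≗h = cong₂ _+_ (g≗h zero) (∑-cong (g≗h ∘ suc))

∑-zero : ∑ {n} (λ _ → + 0) ≡ + 0
∑-zero {n} = trans (∑≡sum {n} (λ _ → + 0)) (Sum.sum-replicate-zero n)

*-distribˡ-∑ : (c : ℤ) (h : Fin n → ℤ) → c * ∑ h ≡ ∑ (λ j → c * h j)
*-distribˡ-∑ c h =
  trans (cong (c *_) (∑≡sum h)) (trans (Sum.*-distribˡ-sum c h) (sym (∑≡sum (λ j → c * h j))))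

*-distribʳ-∑ : (c : ℤ) (h : Fin n → ℤ) → ∑ h * c ≡ ∑ (λ j → h j * c)
*-distribʳ-∑ c h =
  trans (cong (_* c) (∑≡sum h)) (trans (Sum.*-distribʳ-sum c h) (sym (∑≡sum (λ j → h j * c))))

∑-comm : (h : Fin n → Fin m → ℤ) → ∑ (λ j → ∑ (h j)) ≡ ∑ (λ i → ∑ (λ j → h j i))
∑-comm h = begin
  ∑ (λ j → ∑ (h j))                ≡⟨ ∑-cong (λ j → ∑≡sum (h j)) ⟩
  ∑ (λ j → Sum.sum (h j))          ≡⟨ ∑≡sum (λ j → Sum.sum (h j)) ⟩
  Sum.sum (λ j → Sum.sum (h j))    ≡⟨ Sum.∑-comm h ⟩
  Sum.sum (λ i → Sum.sum (λ j → h j i)) ≡⟨ ∑≡sum (λ i → Sum.sum (λ j → h j i)) ⟨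
  ∑ (λ i → Sum.sum (λ j → h j i))  ≡⟨ ∑-cong (λ i → ∑≡sum (λ j → h j i)) ⟨
  ∑ (λ i → ∑ (λ j → h j i))        ∎

∑-permute : (h : Fin n → ℤ) (π : Permutation′ n) → ∑ h ≡ ∑ (h ∘ (π ⟨$⟩ʳ_))
∑-permute h π = trans (∑≡sum h) (trans (Sum.∑-permute h π) (sym (∑≡sum (h ∘ (π ⟨$⟩ʳ_)))))

⟪⟫-congˡ : {c c′ : CoRt k} → c ≗ c′ → (ν : Wt k) → ⟪ c , ν ⟫ ≡ ⟪ c′ , ν ⟫
⟪⟫-congˡ c≗c′ ν = ∑-cong (λ l → cong (_* ν l) (c≗c′ l))

⟪⟫-congʳ : (c : CoRt k) {ν ν′ : Wt k} → ν ≗ ν′ → ⟪ c , ν ⟫ ≡ ⟪ c , ν′ ⟫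
⟪⟫-congʳ c ν≗ν′ = ∑-cong (λ l → cong (c l *_) (ν≗ν′ l))

⟦_⟧ : {P : Set} → Dec P → ℤ
⟦ P? ⟧ = if does P? then + 1 else + 0

∑-⟦≟⟧ : (a : Fin m) → ∑ (λ x → ⟦ a ≟ x ⟧) ≡ + 1
∑-⟦≟⟧ {suc m} zero = cong (_+_ (+ 1)) (∑-zero {m})
∑-⟦≟⟧ (suc a)      = trans (ℤ.+-identityˡ _) (∑-⟦≟⟧ a)

sumℤ : List ℤ → ℤ
sumℤ = foldr _+_ (+ 0)

sumℤ-map-const : {A : Set} (z : ℤ) (xs : List A) → sumℤ (map (λ _ → z) xs) ≡ + length xs * z
sumℤ-map-const z []       = refl
sumℤ-map-const z (_ ∷ xs) = trans (cong (_+_ z) (sumℤ-map-const z xs)) (sym (ℤ.suc-* (+ length xs) z))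

sumℤ-map-≡0 : {A : Set} {g : A → ℤ} {xs : List A} → All (λ x → g x ≡ + 0) xs → sumℤ (map g xs) ≡ + 0
sumℤ-map-≡0 []       = refl
sumℤ-map-≡0 (e ∷ es) = cong₂ _+_ e (sumℤ-map-≡0 es)

sumℤ-filter : {A : Set} {P : A → Set} (P? : Decidable P) (s : Fin k → A) (g : A → ℤ) →
              sumℤ (map g (filter P? (tabulate s))) ≡ ∑ (λ t → ⟦ P? (s t) ⟧ * g (s t))
sumℤ-filter {zero}  P? s g = refl
sumℤ-filter {suc k} P? s g with P? (s zero)
... | yes _ = cong₂ _+_ (sym (ℤ.*-identityˡ (g (s zero)))) (sumℤ-filter P? (s ∘ suc) g)
... | no _  = trans (sumℤ-filter P? (s ∘ suc) g) (sym (ℤ.+-identityˡ _))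

∑orb-⟦⟧ : (orb : Fin n → Fin m) (i : Fin m) (g : Fin n → ℤ) →
          ∑orb orb i g ≡ ∑ (λ j → ⟦ orb j ≟ i ⟧ * g j)
∑orb-⟦⟧ {zero}  orb i g = refl
∑orb-⟦⟧ {suc n} orb i g with orb zero ≟ i
... | yes _ = cong₂ _+_ (sym (ℤ.*-identityˡ (g zero))) (∑orb-⟦⟧ (orb ∘ suc) i (g ∘ suc))
... | no _  = cong (_+_ (+ 0)) (∑orb-⟦⟧ (orb ∘ suc) i (g ∘ suc))

∑orb≡sumℤ : (orb : Fin n → Fin m) (i : Fin m) (g : Fin n → ℤ) →
            ∑orb orb i g ≡ sumℤ (map g (orbitList orb i))
∑orb≡sumℤ orb i g = trans (∑orb-⟦⟧ orb i g) (sym (sumℤ-filter (λ j → orb j ≟ i) (λ j → j) g))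

∑orb-const : (orb : Fin n → Fin m) (i : Fin m) (z : ℤ) → ∑orb orb i (λ _ → z) ≡ + osize orb i * z
∑orb-const orb i z = trans (∑orb≡sumℤ orb i _) (sumℤ-map-const z (orbitList orb i))

∑orb-cong : (orb : Fin n → Fin m) (i : Fin m) {g h : Fin n → ℤ} →
            (∀ j → orb j ≡ i → g j ≡ h j) → ∑orb orb i g ≡ ∑orb orb i h
∑orb-cong orb i {g} {h} g≡h = begin
  ∑orb orb i g                   ≡⟨ ∑orb-⟦⟧ orb i g ⟩
  ∑ (λ j → ⟦ orb j ≟ i ⟧ * g j)  ≡⟨ ∑-cong onOrbit ⟩
  ∑ (λ j → ⟦ orb j ≟ i ⟧ * h j)  ≡⟨ ∑orb-⟦⟧ orb i h ⟨
  ∑orb orb i h                   ∎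
  where
  onOrbit : ∀ j → ⟦ orb j ≟ i ⟧ * g j ≡ ⟦ orb j ≟ i ⟧ * h j
  onOrbit j with orb j ≟ i
  ... | yes p = cong (+ 1 *_) (g≡h j p)
  ... | no _  = refl

*-distribˡ-∑orb : (orb : Fin n → Fin m) (i : Fin m) (c : ℤ) (g : Fin n → ℤ) →
                  c * ∑orb orb i g ≡ ∑orb orb i (λ j → c * g j)
*-distribˡ-∑orb orb i c g = begin
  c * ∑orb orb i g                     ≡⟨ cong (c *_) (∑orb-⟦⟧ orb i g) ⟩
  c * ∑ (λ j → ⟦ orb j ≟ i ⟧ * g j)    ≡⟨ *-distribˡ-∑ c (λ j → ⟦ orb j ≟ i ⟧ * g j) ⟩
  ∑ (λ j → c * (⟦ orb j ≟ i ⟧ * g j))  ≡⟨ ∑-cong (λ j → x∙yz≈y∙xz c ⟦ orb j ≟ i ⟧ (g j)) ⟩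
  ∑ (λ j → ⟦ orb j ≟ i ⟧ * (c * g j))  ≡⟨ ∑orb-⟦⟧ orb i _ ⟨
  ∑orb orb i (λ j → c * g j)           ∎

∑orb-factorˡ : (orb : Fin n → Fin m) (i : Fin m) (G : Fin m → ℤ) (h : Fin n → ℤ) →
               ∑orb orb i (λ j → G (orb j) * h j) ≡ G i * ∑orb orb i h
∑orb-factorˡ orb i G h =
  trans (∑orb-cong orb i (λ j p → cong (λ x → G x * h j) p)) (sym (*-distribˡ-∑orb orb i (G i) h))

∑-partition : (orb : Fin n → Fin m) (g : Fin n → ℤ) → ∑ g ≡ ∑ (λ x → ∑orb orb x g)
∑-partition orb g = sym (begin
  ∑ (λ x → ∑orb orb x g)                       ≡⟨ ∑-cong (λ x → ∑orb-⟦⟧ orb x g) ⟩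
  ∑ (λ x → ∑ (λ j → ⟦ orb j ≟ x ⟧ * g j))      ≡⟨ ∑-comm (λ x j → ⟦ orb j ≟ x ⟧ * g j) ⟩
  ∑ (λ j → ∑ (λ x → ⟦ orb j ≟ x ⟧ * g j))      ≡⟨ ∑-cong (λ j → *-distribʳ-∑ (g j) (λ x → ⟦ orb j ≟ x ⟧)) ⟨
  ∑ (λ j → ∑ (λ x → ⟦ orb j ≟ x ⟧) * g j)      ≡⟨ ∑-cong (λ j → cong (_* g j) (∑-⟦≟⟧ (orb j))) ⟩
  ∑ (λ j → + 1 * g j)                          ≡⟨ ∑-cong (λ j → ℤ.*-identityˡ (g j)) ⟩
  ∑ g                                          ∎)

∑-fibres : (orb : Fin n → Fin m) (G : Fin m → ℤ) → ∑ (λ j → G (orb j)) ≡ ∑ (λ x → + osize orb x * G x)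
∑-fibres orb G = trans (∑-partition orb _) (∑-cong (λ x →
  trans (∑orb-cong orb x (λ j → cong G)) (∑orb-const orb x (G x))))

∑orb-comm : (orb : Fin n → Fin m) (orb′ : Fin k → Fin m′) (x : Fin m) (i : Fin m′) (h : Fin n → Fin k → ℤ) →
            ∑orb orb x (λ l → ∑orb orb′ i (h l)) ≡ ∑orb orb′ i (λ k → ∑orb orb x (λ l → h l k))
∑orb-comm orb orb′ x i h = begin
  ∑orb orb x (λ l → ∑orb orb′ i (h l))          ≡⟨ ∑orb-⟦⟧ orb x _ ⟩
  ∑ (λ l → [ l ] * ∑orb orb′ i (h l))           ≡⟨ ∑-cong expandˡ ⟩
  ∑ (λ l → ∑ (λ k → [ l ] * ([ k ]′ * h l k)))  ≡⟨ ∑-comm (λ l k → [ l ] * ([ k ]′ * h l k)) ⟩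
  ∑ (λ k → ∑ (λ l → [ l ] * ([ k ]′ * h l k)))  ≡⟨ ∑-cong (λ k → ∑-cong (λ l → x∙yz≈y∙xz [ l ] [ k ]′ (h l k))) ⟩
  ∑ (λ k → ∑ (λ l → [ k ]′ * ([ l ] * h l k)))  ≡⟨ ∑-cong expandʳ ⟨
  ∑ (λ k → [ k ]′ * ∑orb orb x (λ l → h l k))   ≡⟨ ∑orb-⟦⟧ orb′ i _ ⟨
  ∑orb orb′ i (λ k → ∑orb orb x (λ l → h l k))  ∎
  where
  [_] : Fin _ → ℤ
  [ l ] = ⟦ orb l ≟ x ⟧
  [_]′ : Fin _ → ℤ
  [ k ]′ = ⟦ orb′ k ≟ i ⟧
  expandˡ : ∀ l → [ l ] * ∑orb orb′ i (h l) ≡ ∑ (λ k → [ l ] * ([ k ]′ * h l k))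
  expandˡ l = trans (cong ([ l ] *_) (∑orb-⟦⟧ orb′ i (h l))) (*-distribˡ-∑ [ l ] (λ k → [ k ]′ * h l k))
  expandʳ : ∀ k → [ k ]′ * ∑orb orb x (λ l → h l k) ≡ ∑ (λ l → [ k ]′ * ([ l ] * h l k))
  expandʳ k = trans (cong ([ k ]′ *_) (∑orb-⟦⟧ orb x (λ l → h l k))) (*-distribˡ-∑ [ k ]′ (λ l → [ l ] * h l k))

∑orb-permute : (orb : Fin n → Fin m) (π : Permutation′ n) → (∀ j → orb (π ⟨$⟩ʳ j) ≡ orb j) →
               (i : Fin m) (g : Fin n → ℤ) → ∑orb orb i g ≡ ∑orb orb i (g ∘ (π ⟨$⟩ʳ_))
∑orb-permute orb π orb∘π≡orb i g = begin
  ∑orb orb i g                                     ≡⟨ ∑orb-⟦⟧ orb i g ⟩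
  ∑ (λ j → ⟦ orb j ≟ i ⟧ * g j)                    ≡⟨ ∑-permute _ π ⟩
  ∑ (λ j → ⟦ orb (π ⟨$⟩ʳ j) ≟ i ⟧ * g (π ⟨$⟩ʳ j))  ≡⟨ ∑-cong (λ j → cong (λ y → ⟦ y ≟ i ⟧ * g (π ⟨$⟩ʳ j)) (orb∘π≡orb j)) ⟩
  ∑ (λ j → ⟦ orb j ≟ i ⟧ * g (π ⟨$⟩ʳ j))           ≡⟨ ∑orb-⟦⟧ orb i _ ⟨
  ∑orb orb i (g ∘ (π ⟨$⟩ʳ_))                       ∎

iter-invariant : {A : Set} (π : Permutation′ n) (h : Fin n → A) → (∀ j → h (π ⟨$⟩ʳ j) ≡ h j) →
                 ∀ t j → h (iter π t j) ≡ h j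
iter-invariant π h inv zero    j = refl
iter-invariant π h inv (suc t) j = trans (inv (iter π t j)) (iter-invariant π h inv t j)

act-cong : (C : Matrix k) (w : Word k) {ν ν′ : Wt k} → ν ≗ ν′ → act C w ν ≗ act C w ν′
act-cong C []      ν≗ν′ l = ν≗ν′ l
act-cong C (i ∷ w) ν≗ν′ l = cong₂ (λ a b → a - b * C l i) (act-cong C w ν≗ν′ l) (act-cong C w ν≗ν′ i)

act-++ : (C : Matrix k) (v w : Word k) (ν : Wt k) → act C (v ++ w) ν ≗ act C v (act C w ν)
act-++ C []      w ν l = refl
act-++ C (i ∷ v) w ν l = cong₂ (λ a b → a - b * C l i) (act-++ C v w ν l) (act-++ C v w ν i)

act-orthogonal : (C : Matrix k) {js : Word k} → AllPairs (λ j j′ → C j j′ ≡ + 0) js →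
                 ∀ ν l → act C js ν l ≡ ν l - sumℤ (map (λ j → ν j * C l j) js)
act-orthogonal C []                 ν l = sym (ℤ.+-identityʳ (ν l))
act-orthogonal C {j ∷ js} (C[j,js]≡0 ∷ orth) ν l = begin
  act C js ν l - act C js ν j * C l j
    ≡⟨ cong₂ (λ a b → a - b * C l j) (act-orthogonal C orth ν l) (act-orthogonal C orth ν j) ⟩
  (ν l - S l) - (ν j - S j) * C l j
    ≡⟨ cong (λ t → (ν l - S l) - (ν j - t) * C l j) (sumℤ-map-≡0 (All.map ν*0≡0 C[j,js]≡0)) ⟩
  (ν l - S l) - (ν j - + 0) * C l j
    ≡⟨ rearrange (ν l) (S l) (ν j) (C l j) ⟩
  ν l - (ν j * C l j + S l)
    ∎
  where
  S : Fin _ → ℤ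
  S l = sumℤ (map (λ j′ → ν j′ * C l j′) js)
  ν*0≡0 : ∀ {j′} → C j j′ ≡ + 0 → ν j′ * C j j′ ≡ + 0
  ν*0≡0 {j′} e = trans (cong (ν j′ *_) e) (ℤ.*-zeroʳ (ν j′))
  rearrange : ∀ a s b c → (a - s) - (b - + 0) * c ≡ a - (b * c + s)
  rearrange = solve-∀

allPairs-restrict : {A : Set} {P : A → Set} {R S : A → A → Set} {xs : List A} →
                    (∀ {x y} → P x → P y → R x y → S x y) → All P xs → AllPairs R xs → AllPairs S xs
allPairs-restrict f []         []         = []
allPairs-restrict f (px ∷ pxs) (rx ∷ rxs) =
  All.zipWith (λ (py , r) → f px py r) (pxs , rx) ∷ allPairs-restrict f pxs rxs

∣-foldr-lcm : {x : ℕ} {xs : List ℕ} → x ∈ xs → x ∣ foldr lcm 1 xs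
∣-foldr-lcm {xs = y ∷ ys} (here refl)  = m∣lcm[m,n] y _
∣-foldr-lcm {xs = y ∷ ys} (there x∈ys) = ∣-trans (∣-foldr-lcm x∈ys) (n∣lcm[m,n] y _)

m-div-n*n≡m : {a b : ℕ} .{{_ : NonZero b}} → b ∣ a → a div b ℕ.* b ≡ a
m-div-n*n≡m {b = suc _} = m/n*n≡m

length-nonZero : {A : Set} {x : A} {xs : List A} → x ∈ xs → NonZero (length xs)
length-nonZero {xs = _ ∷ _} _ = _

ratio-rescale : {p q : ℕ} {u v a b K : ℤ} .{{_ : NonZero p}} .{{_ : NonZero q}} →
                u * + p ≡ K → v * + q ≡ K → + q * a ≡ + p * b → u * a ≡ v * b
ratio-rescale {p} {q} {u} {v} {a} {b} up≡K vq≡K qa≡pb =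
  ℤ.*-cancelˡ-≡ (+ p) _ _ (ℤ.*-cancelˡ-≡ (+ q) _ _ (begin
    + q * (+ p * (u * a))    ≡⟨ swap (+ q) (+ p) u a ⟩
    (u * + p) * (+ q * a)    ≡⟨ cong₂ _*_ (trans up≡K (sym vq≡K)) qa≡pb ⟩
    (v * + q) * (+ p * b)    ≡⟨ swap (+ p) (+ q) v b ⟨
    + p * (+ q * (v * b))    ≡⟨ x∙yz≈y∙xz (+ p) (+ q) (v * b) ⟩
    + q * (+ p * (v * b))    ∎))
  where
  swap : ∀ x y z w → x * (y * (z * w)) ≡ (z * y) * (x * w)
  swap = solve-∀

module _ {n m : ℕ} (F : Folding n m) where
  open Folding F

  κ/o : Fin m → ℕ
  κ/o x = κ F div o F x

  o-nonZero : ∀ x → NonZero (o F x)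
  o-nonZero x =
    let (j , orb[j]≡x) = orb-surj x in
    length-nonZero (∈-filter⁺ (λ j → orb j ≟ x) (∈-allFin j) orb[j]≡x)

  κ/o*o≡κ : ∀ x → + κ/o x * + o F x ≡ + κ F
  κ/o*o≡κ x = trans (sym (ℤ.pos-* (κ/o x) (o F x)))
    (cong +_ (m-div-n*n≡m {{o-nonZero x}} (∣-foldr-lcm (∈-map⁺ (o F) (∈-allFin x)))))

  rescale : ∀ x y {a b} → + o F x * a ≡ + o F y * b → + κ/o y * a ≡ + κ/o x * b
  rescale x y =
    ratio-rescale {u = + κ/o y} {v = + κ/o x} {{o-nonZero y}} {{o-nonZero x}} (κ/o*o≡κ y) (κ/o*o≡κ x)

  orb∘π≡orb : ∀ j → orb (π ⟨$⟩ʳ j) ≡ orb j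
  orb∘π≡orb j = sym (orb-complete j (π ⟨$⟩ʳ j) (1 , refl))

  orbitList-orthogonal : ∀ i → AllPairs (λ j j′ → B j j′ ≡ + 0) (orbitList orb i)
  orbitList-orthogonal i =
    allPairs-restrict sameOrbit (all-filter onOrbit? (allFin n)) (AllPairs.filter⁺ onOrbit? (allFin⁺ n))
    where
    onOrbit? : Decidable (λ j → orb j ≡ i)
    onOrbit? j = orb j ≟ i
    sameOrbit : ∀ {j j′} → orb j ≡ i → orb j′ ≡ i → j ≢ j′ → B j j′ ≡ + 0
    sameOrbit {j} {j′} p p′ j≢j′ = admissible j j′ j≢j′ (orb-sound j j′ (trans p (sym p′)))

  φ-ψ-pairing : ∀ c λw → ⟪ φ F c , ψ F λw ⟫ ≡ + κ F * ⟪ c , λw ⟫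
  φ-ψ-pairing c λw = begin
    ⟪ φ F c , ψ F λw ⟫                             ≡⟨ ∑-fibres orb (λ x → c x * (+ κ/o x * λw x)) ⟩
    ∑ (λ x → + o F x * (c x * (+ κ/o x * λw x)))   ≡⟨ ∑-cong o*[c*[κ/o*λ]]≡κ*[c*λ] ⟩
    ∑ (λ x → + κ F * (c x * λw x))                 ≡⟨ *-distribˡ-∑ (+ κ F) (λ x → c x * λw x) ⟨
    + κ F * ⟪ c , λw ⟫                             ∎
    where
    regroup : ∀ o c d l → o * (c * (d * l)) ≡ (d * o) * (c * l)
    regroup = solve-∀
    o*[c*[κ/o*λ]]≡κ*[c*λ] : ∀ x → + o F x * (c x * (+ κ/o x * λw x)) ≡ + κ F * (c x * λw x)
    o*[c*[κ/o*λ]]≡κ*[c*λ] x =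
      trans (regroup (+ o F x) (c x) (+ κ/o x) (λw x)) (cong (_* (c x * λw x)) (κ/o*o≡κ x))

  ψ-reflection : ∀ i μ → ψ F (refl-s A i μ) ≗ act B (orbitList orb i) (ψ F μ)
  ψ-reflection i μ j = sym (begin
    act B (orbitList orb i) (ψ F μ) j
      ≡⟨ act-orthogonal B (orbitList-orthogonal i) (ψ F μ) j ⟩
    ψ F μ j - sumℤ (map (λ k → ψ F μ k * B j k) (orbitList orb i))
      ≡⟨ cong (ψ F μ j -_) (∑orb≡sumℤ orb i (λ k → ψ F μ k * B j k)) ⟨
    ψ F μ j - ∑orb orb i (λ k → ψ F μ k * B j k)
      ≡⟨ cong (ψ F μ j -_) (∑orb-factorˡ orb i (λ x → + κ/o x * μ x) (B j)) ⟩
    + κ/o y * μ y - (+ κ/o i * μ i) * ∑orb orb i (B j)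
      ≡⟨ regroup (+ κ/o y) (μ y) (μ i) (+ κ/o i) (∑orb orb i (B j)) ⟩
    + κ/o y * μ y - μ i * (+ κ/o i * ∑orb orb i (B j))
      ≡⟨ cong (λ t → + κ/o y * μ y - μ i * t) (rescale i y (A-def y i j refl)) ⟨
    + κ/o y * μ y - μ i * (+ κ/o y * A y i)
      ≡⟨ factor (+ κ/o y) (μ y) (μ i) (A y i) ⟩
    + κ/o y * (μ y - μ i * A y i)
      ∎)
    where
    y = orb j
    regroup : ∀ d x xᵢ dᵢ s → d * x - (dᵢ * xᵢ) * s ≡ d * x - xᵢ * (dᵢ * s)
    regroup = solve-∀
    factor : ∀ d x xᵢ a → d * x - xᵢ * (d * a) ≡ d * (x - xᵢ * a)
    factor = solve-∀

  ψ-equivariant : ∀ Λ w → ψ F (act A w Λ) ≗ act B (f F w) (ψ F Λ)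
  ψ-equivariant Λ []      j = refl
  ψ-equivariant Λ (i ∷ w) j = begin
    ψ F (refl-s A i (act A w Λ)) j                        ≡⟨ ψ-reflection i (act A w Λ) j ⟩
    act B (orbitList orb i) (ψ F (act A w Λ)) j           ≡⟨ act-cong B (orbitList orb i) (ψ-equivariant Λ w) j ⟩
    act B (orbitList orb i) (act B (f F w) (ψ F Λ)) j     ≡⟨ act-++ B (orbitList orb i) (f F w) (ψ F Λ) j ⟨
    act B (f F (i ∷ w)) (ψ F Λ) j                         ∎

  φ-ψ-pairing-act : ∀ w Λ c → ⟪ φ F c , act B (f F w) (ψ F Λ) ⟫ ≡ + κ F * ⟪ c , act A w Λ ⟫
  φ-ψ-pairing-act w Λ c =
    trans (⟪⟫-congʳ (φ F c) (λ j → sym (ψ-equivariant Λ w j))) (φ-ψ-pairing c (act A w Λ))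

  β̃≗φαᵛ : ∀ i → β̃ F i ≗ φ F (αᵛ F i)
  β̃≗φαᵛ i j with orb j ≟ i
  ... | yes _ = refl
  ... | no _  = refl

  β̃-pairing-act : ∀ w Λ i → ⟪ β̃ F i , act B (f F w) (ψ F Λ) ⟫ ≡ + κ F * ⟪ αᵛ F i , act A w Λ ⟫
  β̃-pairing-act w Λ i =
    trans (⟪⟫-congˡ (β̃≗φαᵛ i) (act B (f F w) (ψ F Λ))) (φ-ψ-pairing-act w Λ (αᵛ F i))

  columnSum : Fin m → Fin n → ℤ
  columnSum x k = ∑orb orb x (λ l → B l k)

  columnSum-π-invariant : ∀ x k → columnSum x (π ⟨$⟩ʳ k) ≡ columnSum x k
  columnSum-π-invariant x k =
    trans (∑orb-permute orb π orb∘π≡orb x (λ l → B l (π ⟨$⟩ʳ k))) (∑orb-cong orb x (λ l _ → B-inv l k))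

  columnSum-orbit-constant : ∀ x {k k′} → orb k ≡ orb k′ → columnSum x k′ ≡ columnSum x k
  columnSum-orbit-constant x {k} {k′} orb[k]≡orb[k′] =
    let (t , πᵗk≡k′) = orb-sound k k′ orb[k]≡orb[k′] in
    trans (cong (columnSum x) (sym πᵗk≡k′)) (iter-invariant π (columnSum x) (columnSum-π-invariant x) t k)

  blockSum : ∀ x i → ∑orb orb x (λ l → ∑orb orb i (B l)) ≡ + o F i * A x i
  blockSum x i = ℤ.*-cancelˡ-≡ (+ o F x) _ _ {{o-nonZero x}} (begin
    + o F x * ∑orb orb x (λ l → ∑orb orb i (B l))    ≡⟨ *-distribˡ-∑orb orb x (+ o F x) (λ l → ∑orb orb i (B l)) ⟩
    ∑orb orb x (λ l → + o F x * ∑orb orb i (B l))    ≡⟨ ∑orb-cong orb x (λ l orb[l]≡x → sym (A-def x i l orb[l]≡x)) ⟩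
    ∑orb orb x (λ _ → + o F i * A x i)               ≡⟨ ∑orb-const orb x (+ o F i * A x i) ⟩
    + o F x * (+ o F i * A x i)                      ∎)

  columnSum≡A : ∀ x k → columnSum x k ≡ A x (orb k)
  columnSum≡A x k = ℤ.*-cancelˡ-≡ (+ o F i) _ _ {{o-nonZero i}} (begin
    + o F i * columnSum x k                          ≡⟨ ∑orb-const orb i (columnSum x k) ⟨
    ∑orb orb i (λ _ → columnSum x k)                 ≡⟨ ∑orb-cong orb i (λ _ p → sym (columnSum-orbit-constant x (sym p))) ⟩
    ∑orb orb i (columnSum x)                         ≡⟨ ∑orb-comm orb orb x i B ⟨
    ∑orb orb x (λ l → ∑orb orb i (B l))              ≡⟨ blockSum x i ⟩
    + o F i * A x i                                  ∎)
    where
    i = orb k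

  φ-preserves-centre : ∀ c → InCentre A c → InCentre B (φ F c)
  φ-preserves-centre c central k = begin
    ∑ (λ l → c (orb l) * B l k)                      ≡⟨ ∑-partition orb (λ l → c (orb l) * B l k) ⟩
    ∑ (λ x → ∑orb orb x (λ l → c (orb l) * B l k))   ≡⟨ ∑-cong (λ x → ∑orb-factorˡ orb x c (λ l → B l k)) ⟩
    ∑ (λ x → c x * columnSum x k)                    ≡⟨ ∑-cong (λ x → cong (c x *_) (columnSum≡A x k)) ⟩
    ∑ (λ x → c x * A x (orb k))                      ≡⟨ central (orb k) ⟩
    + 0                                              ∎

theorem4p5 : ∀ {n m : ℕ} (F : Folding n m) →
      (∀ (c : CoRt m) (λw : Wt m) → ⟪ φ F c , ψ F λw ⟫ ≡ + κ F * ⟪ c , λw ⟫)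
    × (∀ (Λ : Wt m) (w : Word m) (j : Fin n) →
         ψ F (act (Folding.A F) w Λ) j ≡ act (Folding.B F) (f F w) (ψ F Λ) j)
    × (∀ (w : Word m) (Λ : Wt m) (c : CoRt m) →
         ⟪ φ F c , act (Folding.B F) (f F w) (ψ F Λ) ⟫
           ≡ + κ F * ⟪ c , act (Folding.A F) w Λ ⟫)
    × (∀ (w : Word m) (Λ : Wt m) (i : Fin m) →
         ⟪ β̃ F i , act (Folding.B F) (f F w) (ψ F Λ) ⟫
           ≡ + κ F * ⟪ αᵛ F i , act (Folding.A F) w Λ ⟫)
    × (∀ (c : CoRt m) → InCentre (Folding.A F) c → InCentre (Folding.B F) (φ F c))
theorem4p5 F =
  φ-ψ-pairing F , ψ-equivariant F , φ-ψ-pairing-act F , β̃-pairing-act F , φ-preserves-centre F
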